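{- If $X\subseteq2^\omega$ and $s\in2^{<\omega}$, then $\mathcal{F}_{s^\frown X}$ is the filter on $\omega$ generated by the family $\{a+|s| : a\in\mathcal{F}_X\}$.
   Context: Subsets of $\omega$ are identified with elements of $2^\omega$. For $a\subseteq\omega$ and $n\in\omega$, $a+n=\{k+n:k\in a\}$; for $X\subseteq2^\omega$ and $s\in2^{<\omega}$, $s^\frown X=\{s^\frown x:x\in X\}$. For distinct $x,y\in2^\omega$ let $h(x,y)=\min\{n:x(n)\ne y(n)\}$; for $X\subseteq2^\omega$, $H(X)=\{h(x,y):x,y\in X,x\ne y\}$. The Raisonnier filter $\mathcal{F}_X$ is the set of all $a\subseteq\omega$ for which there is a countable family $\{Y_n:n<\omega\}$ of subsets of $2^\omega$ with $X\subseteq\bigcup_nY_n$ and $a\supseteq\bigcup_nH(Y_n)$. -}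

module Defs where

open import Data.Nat using (ℕ; zero; suc; _+_; _<_)
open import Data.Bool using (Bool)
open import Data.List using (List; []; _∷_; length)
open import Data.List.Relation.Unary.All using (All)
open import Data.Product using (Σ; _×_; ∃)
open import Relation.Binary.PropositionalEquality using (_≡_; _≢_)
open import Function.Bundles using (_⇔_)

Subℕ : Set₁
Subℕ = ℕ → Set

Cantor : Set
Cantor = ℕ → Bool

SubC : Set₁
SubC = Cantor → Set

_⊕_ : Subℕ → ℕ → Subℕ
(a ⊕ n) k = Σ ℕ λ m → a m × (k ≡ m + n)

_⁀_ : List Bool → Cantor → Cantor
([] ⁀ x) n = x n
((b ∷ s) ⁀ x) zero = b
((b ∷ s) ⁀ x) (suc n) = (s ⁀ x) n

_⁀ˢ_ : List Bool → SubC → SubC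
(s ⁀ˢ X) z = Σ Cantor λ x → X x × (∀ n → z n ≡ (s ⁀ x) n)

IsH : Cantor → Cantor → ℕ → Set
IsH x y k = (x k ≢ y k) × (∀ i → i < k → x i ≡ y i)

H : SubC → Subℕ
H Y k = Σ Cantor λ x → Σ Cantor λ y → Y x × Y y × (∃ λ n → x n ≢ y n) × IsH x y k

Raisonnier : SubC → Subℕ → Set₁
Raisonnier X a =
  Σ (ℕ → SubC) λ Y →
    (∀ x → X x → ∃ λ n → Y n x) × (∀ n k → H (Y n) k → a k)

-- Filter on ω generated by a family G of subsets of ω:
-- sets containing the intersection of finitely many members of G (empty intersection = ω).
GeneratedFilter : (Subℕ → Set₁) → Subℕ → Set₁
GeneratedFilter G b =
  Σ (List Subℕ) λ as → All G as × (∀ k → All (λ a → a k) as → b k)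

ShiftedFamily : SubC → ℕ → Subℕ → Set₁
ShiftedFamily X n b = Σ Subℕ λ a → Raisonnier X a × (∀ k → (b k → (a ⊕ n) k) × ((a ⊕ n) k → b k))

{-# OPTIONS --safe #-}
module Submission where

open import Defs
open import Data.Bool using (Bool)
open import Data.Empty using (⊥-elim)
open import Data.List using (List; length; []; _∷_)
open import Data.List.Relation.Unary.All using (All; []; _∷_)
open import Data.Nat using (ℕ; zero; suc; _+_; s<s)
open import Data.Nat.Properties using (+-identityʳ; +-suc; suc-injective)
open import Data.Product using (Σ; _×_; ∃; _,_; proj₁; proj₂)
open import Data.Unit using (tt)
open import Function using (_∘_; id)
open import Function.Bundles using (_⇔_; mk⇔)
open import Relation.Binary.PropositionalEquality using (_≡_; _≗_; refl; sym; trans; cong; subst)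
open import Relation.Unary using (_⊆_; _∩_; U)

-- Prefixing s shifts every splitting level by |s|: h(s⁀x, s⁀y) = h(x, y) + |s|.  So a cover
-- of s⁀X witnessing b ∈ 𝓕_{s⁀X} pulls back to a cover of X witnessing
-- {m : m + |s| ∈ b} ∈ 𝓕_X, whose shift lies inside b; and a cover of X witnessing
-- a ∈ 𝓕_X pushes forward to a cover of s⁀X witnessing a + |s|.  A finite intersection
-- of generators contains a single one because 𝓕_X is closed under finite intersections:
-- two countable covers have a countable common refinement, indexed through an
-- enumeration of ℕ × ℕ.

next : ℕ × ℕ → ℕ × ℕ
next (zero  , j) = suc j , zero
next (suc i , j) = i , suc j

unpair : ℕ → ℕ × ℕ
unpair zero    = zero , zero
unpair (suc n) = next (unpair n)

unpair-surjective : ∀ p → ∃ λ n → unpair n ≡ p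
unpair-surjective (i , j) = reach (i + j) i j refl
  where
  reach : ∀ d i j → i + j ≡ d → ∃ λ n → unpair n ≡ (i , j)
  reach d       zero    zero    _ = zero , refl
  reach d       i       (suc j) e =
    let n , p = reach d (suc i) j (trans (sym (+-suc i j)) e) in suc n , cong next p
  reach (suc d) (suc i) zero    e =
    let n , p = reach d zero i (trans (sym (+-identityʳ i)) (suc-injective e)) in suc n , cong next p

module _ {x y : Cantor} where

  IsH-resp-≗ : ∀ {x′ y′ k} → x ≗ x′ → y ≗ y′ → IsH x y k → IsH x′ y′ k
  IsH-resp-≗ x≗x′ y≗y′ (x≢y , agree) =
    (λ e → x≢y (trans (x≗x′ _) (trans e (sym (y≗y′ _))))) ,
    (λ i i<k → trans (sym (x≗x′ i)) (trans (agree i i<k) (y≗y′ i)))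

  IsH-suc : ∀ {k} → x zero ≡ y zero → IsH (x ∘ suc) (y ∘ suc) k → IsH x y (suc k)
  IsH-suc x₀≡y₀ (x≢y , agree) = x≢y , λ where
    zero    _         → x₀≡y₀
    (suc i) (s<s i<k) → agree i i<k

  IsH-suc⁻¹ : ∀ {k} → IsH x y (suc k) → IsH (x ∘ suc) (y ∘ suc) k
  IsH-suc⁻¹ (x≢y , agree) = x≢y , λ i i<k → agree (suc i) (s<s i<k)

IsH-⁀ : ∀ s {x y k} → IsH x y k → IsH (s ⁀ x) (s ⁀ y) (k + length s)
IsH-⁀ []      {k = k} h = subst (IsH _ _) (sym (+-identityʳ k)) h
IsH-⁀ (b ∷ s) {k = k} h = subst (IsH _ _) (sym (+-suc k (length s))) (IsH-suc refl (IsH-⁀ s h))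

IsH-⁀⁻¹ : ∀ s {x y k} → IsH (s ⁀ x) (s ⁀ y) k → (IsH x y ⊕ length s) k
IsH-⁀⁻¹ []      {k = k}     h = k , h , sym (+-identityʳ k)
IsH-⁀⁻¹ (b ∷ s) {k = zero}  (b≢b , _) = ⊥-elim (b≢b refl)
IsH-⁀⁻¹ (b ∷ s) {k = suc k} h with IsH-⁀⁻¹ s (IsH-suc⁻¹ h)
... | j , hj , refl = j , hj , sym (+-suc j (length s))

H-intro : ∀ {Y : SubC} {x y k} → Y x → Y y → IsH x y k → H Y k
H-intro Yx Yy h = _ , _ , Yx , Yy , (_ , proj₁ h) , h

H-mono : ∀ {Y Y′ : SubC} → Y ⊆ Y′ → H Y ⊆ H Y′
H-mono Y⊆Y′ (x , y , Yx , Yy , x≢y , h) = x , y , Y⊆Y′ Yx , Y⊆Y′ Yy , x≢y , h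

H-preimage-⁀ : ∀ s {Y : SubC} {k} → H (Y ∘ (s ⁀_)) k → H Y (k + length s)
H-preimage-⁀ s (_ , _ , Yx , Yy , _ , h) = H-intro Yx Yy (IsH-⁀ s h)

H-⁀ˢ : ∀ s {Y : SubC} → H (s ⁀ˢ Y) ⊆ H Y ⊕ length s
H-⁀ˢ s (_ , _ , (x , Yx , z≗) , (y , Yy , z′≗) , _ , h)
  with IsH-⁀⁻¹ s (IsH-resp-≗ z≗ z′≗ h)
... | j , hj , k≡j+|s| = j , H-intro Yx Yy hj , k≡j+|s|

module _ {X : SubC} where

  Raisonnier-mono : ∀ {a b : Subℕ} → a ⊆ b → Raisonnier X a → Raisonnier X b
  Raisonnier-mono a⊆b (Y , cover , bound) = Y , cover , λ n k h → a⊆b (bound n k h)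

  Raisonnier-U : Raisonnier X U
  Raisonnier-U = (λ _ → U) , (λ _ _ → zero , tt) , λ _ _ _ → tt

  Raisonnier-∩ : ∀ {a a′ : Subℕ} → Raisonnier X a → Raisonnier X a′ → Raisonnier X (a ∩ a′)
  Raisonnier-∩ {a} {a′} (Y , cover , bound) (Y′ , cover′ , bound′) = Z , coverZ , boundZ
    where
    Z : ℕ → SubC
    Z n = Y (proj₁ (unpair n)) ∩ Y′ (proj₂ (unpair n))

    coverZ : ∀ x → X x → ∃ λ n → Z n x
    coverZ x Xx =
      let i , Yix   = cover x Xx
          j , Y′jx  = cover′ x Xx
          n , n↦i,j = unpair-surjective (i , j)
      in n , subst (λ (i , j) → Y i x × Y′ j x) (sym n↦i,j) (Yix , Y′jx)

    boundZ : ∀ n k → H (Z n) k → (a ∩ a′) k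
    boundZ n k h = bound _ k (H-mono proj₁ h) , bound′ _ k (H-mono proj₂ h)

  Raisonnier-⁀ : ∀ s {a : Subℕ} → Raisonnier X a → Raisonnier (s ⁀ˢ X) (a ⊕ length s)
  Raisonnier-⁀ s {a} (Y , cover , bound) = (λ n → s ⁀ˢ Y n) , cover⁀ , bound⁀
    where
    cover⁀ : ∀ z → (s ⁀ˢ X) z → ∃ λ n → (s ⁀ˢ Y n) z
    cover⁀ z (x , Xx , z≗) = let n , Ynx = cover x Xx in n , x , Ynx , z≗

    bound⁀ : ∀ n k → H (s ⁀ˢ Y n) k → (a ⊕ length s) k
    bound⁀ n k h = let j , hj , k≡j+|s| = H-⁀ˢ s h in j , bound n j hj , k≡j+|s|

  Raisonnier-⁀⁻¹ : ∀ s {b : Subℕ} → Raisonnier (s ⁀ˢ X) b → Raisonnier X (b ∘ (_+ length s))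
  Raisonnier-⁀⁻¹ s (Y , cover , bound) =
    (λ n → Y n ∘ (s ⁀_)) ,
    (λ x Xx → cover (s ⁀ x) (x , Xx , λ _ → refl)) ,
    (λ n k h → bound n (k + length s) (H-preimage-⁀ s h))

  ShiftedFamily-⋂ : ∀ {n} {bs : List Subℕ} → All (ShiftedFamily X n) bs →
    Σ Subℕ λ a → Raisonnier X a × (a ⊕ n ⊆ λ k → All (λ b → b k) bs)
  ShiftedFamily-⋂ [] = U , Raisonnier-U , λ _ → []
  ShiftedFamily-⋂ ((a , r , b≐a⊕n) ∷ gs) =
    let a′ , r′ , a′⊕n⊆ = ShiftedFamily-⋂ gs
    in a ∩ a′ , Raisonnier-∩ r r′ ,
       λ { (m , (am , a′m) , refl) → proj₂ (b≐a⊕n _) (m , am , refl) ∷ a′⊕n⊆ (m , a′m , refl) }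

proposition3p7 : (X : SubC) (s : List Bool) (b : Subℕ) →
    Raisonnier (s ⁀ˢ X) b ⇔ GeneratedFilter (ShiftedFamily X (length s)) b
proposition3p7 X s b = mk⇔ toGenerated fromGenerated
  where
  toGenerated : Raisonnier (s ⁀ˢ X) b → GeneratedFilter (ShiftedFamily X (length s)) b
  toGenerated r =
    (b ∘ (_+ length s)) ⊕ length s ∷ [] ,
    (_ , Raisonnier-⁀⁻¹ s r , λ _ → id , id) ∷ [] ,
    λ { _ ((_ , bm , refl) ∷ []) → bm }

  fromGenerated : GeneratedFilter (ShiftedFamily X (length s)) b → Raisonnier (s ⁀ˢ X) b
  fromGenerated (_ , gs , ⋂bs⊆b) =
    let a , r , a⊕|s|⊆⋂bs = ShiftedFamily-⋂ gs
    in Raisonnier-mono (⋂bs⊆b _ ∘ a⊕|s|⊆⋂bs) (Raisonnier-⁀ s r)
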